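{- In Blizzard, played on a finite graph $G=(V,E)$ with a set $X$ of exits and a starting vertex $s$, the trapper has a winning strategy if and only if $s$ is adjacent to a vertex of $W$, where $W$ is defined as follows: $W_0=X$, and for $k\ge 1$, $W_k$ is the set of vertices having at least two neighbors in $\bigcup_{i<k}W_i$; the construction is continued until it adds no new vertices, and $W=\bigcup_{k}W_k$.
   Context: Blizzard is a two-player game. An instance consists of a finite graph $G=(V,E)$, a set $X\subseteq V$ of vertices called exits, and a starting vertex $s$ for the first player, the trapper. In each round the trapper first moves from his current vertex to an adjacent vertex along an edge still present; then the second player, the Storm, permanently deletes one edge incident with the trapper's current vertex. The trapper wins if he reaches an exit; the Storm wins if the trapper ends up in a connected component of the current graph containing no exit. -}

module Defs where

open import Data.Nat using (ℕ; zero; suc)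
open import Data.Fin using (Fin; _≟_)
open import Data.Fin.Subset using (Subset; _∈_)
open import Data.Bool using (Bool; true; false; if_then_else_)
open import Data.Product using (Σ; _×_; ∃)
open import Data.Sum using (_⊎_)
open import Data.Empty using (⊥)
open import Relation.Nullary using (¬_)
open import Relation.Nullary.Decidable using (⌊_⌋)
open import Relation.Binary.PropositionalEquality using (_≡_)
open import Data.Bool using (_∧_; _∨_)

record Graph (n : ℕ) : Set where
  field
    adj    : Fin n → Fin n → Bool
    sym    : ∀ x y → adj x y ≡ adj y x
    irrefl : ∀ x → adj x x ≡ false
open Graph public

EdgeSet : ℕ → Set
EdgeSet n = Fin n → Fin n → Bool

deleteEdge : ∀ {n} → EdgeSet n → Fin n → Fin n → EdgeSet n
deleteEdge E a b x y =
  if (⌊ x ≟ a ⌋ ∧ ⌊ y ≟ b ⌋) ∨ (⌊ x ≟ b ⌋ ∧ ⌊ y ≟ a ⌋) then false else E x y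

-- TrapperWins X E v : in the position where the trapper is at v, the
-- current edge set is E and it is the trapper's turn to move, the trapper
-- has a winning strategy.  A round: the trapper moves along a present edge
-- v–u; if u is an exit he wins; otherwise the Storm deletes any present
-- edge u–w incident with u, and the trapper must win from the new position.
-- (Inductive = the trapper forces reaching an exit in finitely many rounds;
-- since every round deletes an edge the game is finite, so this is exactly
-- the existence of a winning strategy.)
data TrapperWins {n : ℕ} (X : Subset n) : EdgeSet n → Fin n → Set where
  reachExit : ∀ {E v} (u : Fin n) → E v u ≡ true → u ∈ X → TrapperWins X E v
  move      : ∀ {E v} (u : Fin n) → E v u ≡ true →
              (∀ (w : Fin n) → E u w ≡ true → TrapperWins X (deleteEdge E u w) u) →
              TrapperWins X E v

mutual
  WStage : ∀ {n} → Graph n → Subset n → ℕ → Fin n → Set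
  WStage G X zero v = v ∈ X
  WStage {n} G X (suc k) v =
    Σ (Fin n) λ u₁ → Σ (Fin n) λ u₂ →
      ¬ (u₁ ≡ u₂) × adj G v u₁ ≡ true × adj G v u₂ ≡ true ×
      WBelow G X (suc k) u₁ × WBelow G X (suc k) u₂

  WBelow : ∀ {n} → Graph n → Subset n → ℕ → Fin n → Set
  WBelow G X zero v = ⊥
  WBelow G X (suc k) v = WBelow G X k v ⊎ WStage G X k v

InW : ∀ {n} → Graph n → Subset n → Fin n → Set
InW G X v = ∃ λ k → WStage G X k v

-- W is the set of vertices at which the trapper, having just moved there,
-- can force a win.  A vertex with two neighbours in W is good: whichever
-- edge the Storm deletes, one edge into W remains.  Conversely, if the trapper
-- wins after stepping to u, he wins against the Storm deleting the edge back, so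
-- u has a neighbour z₁ in W; he also wins against the deletion of u–z₁, giving a
-- second neighbour z₂ ≠ z₁ in W, and W only grows with the graph.  For the
-- converse the key point is that deleting edges at a vertex w outside W_{<k}
-- leaves W_{<k} intact, since every edge used to certify membership in W_{<k}
-- joins two members of W_{<k}.
module Submission where

open import Defs
open import Data.Nat using (ℕ; zero; suc; _≤′_; ≤′-refl; ≤′-step; _⊔_; s≤s)
open import Data.Nat.Properties using (≤⇒≤′; m≤m⊔n; m≤n⊔m)
open import Data.Fin using (Fin; _≟_)
open import Data.Fin.Subset using (Subset)
open import Data.Bool using (true; false; if_then_else_; _∧_; _∨_)
open import Data.Bool.Properties using (∧-comm; ∨-comm)
open import Data.Product using (∃; _×_; _,_; map₂)
open import Data.Sum using (_⊎_; inj₁; inj₂; [_,_]′) renaming (map to ⊎-map)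
open import Data.Empty using (⊥-elim)
open import Function using (id)
open import Function.Bundles using (_⇔_; mk⇔)
open import Relation.Nullary using (yes; no)
open import Relation.Nullary.Decidable using (⌊_⌋)
open import Relation.Binary.PropositionalEquality
  using (_≡_; _≢_; refl; cong₂; trans; ≢-sym; module ≡-Reasoning)
open ≡-Reasoning

variable
  n k : ℕ
  a b u v w x y : Fin n
  G H : Graph n
  X : Subset n

deleteEdge-cases : (E : EdgeSet n) (a b x y : Fin n) →
                   deleteEdge E a b x y ≡ false ⊎ deleteEdge E a b x y ≡ E x y
deleteEdge-cases E a b x y
  with (⌊ x ≟ a ⌋ ∧ ⌊ y ≟ b ⌋) ∨ (⌊ x ≟ b ⌋ ∧ ⌊ y ≟ a ⌋)
... | true  = inj₁ refl
... | false = inj₂ refl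

deleteEdge-⊆ : (E : EdgeSet n) → deleteEdge E a b x y ≡ true → E x y ≡ true
deleteEdge-⊆ {a = a} {b = b} {x = x} {y = y} E
  with (⌊ x ≟ a ⌋ ∧ ⌊ y ≟ b ⌋) ∨ (⌊ x ≟ b ⌋ ∧ ⌊ y ≟ a ⌋)
... | true  = λ ()
... | false = id

deleteEdge-removes : (E : EdgeSet n) (a b : Fin n) → deleteEdge E a b a b ≢ true
deleteEdge-removes E a b with a ≟ a | b ≟ b
... | yes _  | yes _  = λ ()
... | no a≢a | _      = ⊥-elim (a≢a refl)
... | yes _  | no b≢b = ⊥-elim (b≢b refl)

deleteEdge-remaining≢ : (E : EdgeSet n) → deleteEdge E a b a y ≡ true → y ≢ b
deleteEdge-remaining≢ {a = a} {b = b} E present refl = deleteEdge-removes E a b present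

≟-both-false : x ≢ a ⊎ y ≢ b → ⌊ x ≟ a ⌋ ∧ ⌊ y ≟ b ⌋ ≡ false
≟-both-false {x = x} {a = a} {y = y} {b = b} h with x ≟ a | y ≟ b
... | no _  | _     = refl
... | yes _ | no _  = refl
... | yes p | yes q = ⊥-elim ([ (λ x≢a → x≢a p) , (λ y≢b → y≢b q) ]′ h)

deleteEdge-other : (E : EdgeSet n) → x ≢ a ⊎ y ≢ b → x ≢ b ⊎ y ≢ a →
                   deleteEdge E a b x y ≡ E x y
deleteEdge-other {x = x} {a = a} {y = y} {b = b} E h h′
  rewrite ≟-both-false {x = x} {a = a} {y = y} {b = b} h
        | ≟-both-false {x = x} {a = b} {y = y} {b = a} h′ = refl

deleteGraphEdge : Graph n → Fin n → Fin n → Graph n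
deleteGraphEdge G a b = record
  { adj    = deleteEdge (adj G) a b
  ; sym    = λ x y → cong₂ (λ c e → if c then false else e) (matches-sym x y) (sym G x y)
  ; irrefl = λ x → [ id , (λ same → trans same (irrefl G x)) ]′
                       (deleteEdge-cases (adj G) a b x x)
  }
  where
  matches-sym : ∀ x y → (⌊ x ≟ a ⌋ ∧ ⌊ y ≟ b ⌋) ∨ (⌊ x ≟ b ⌋ ∧ ⌊ y ≟ a ⌋)
                      ≡ (⌊ y ≟ a ⌋ ∧ ⌊ x ≟ b ⌋) ∨ (⌊ y ≟ b ⌋ ∧ ⌊ x ≟ a ⌋)
  matches-sym x y = begin
    (⌊ x ≟ a ⌋ ∧ ⌊ y ≟ b ⌋) ∨ (⌊ x ≟ b ⌋ ∧ ⌊ y ≟ a ⌋)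
      ≡⟨ ∨-comm (⌊ x ≟ a ⌋ ∧ ⌊ y ≟ b ⌋) _ ⟩
    (⌊ x ≟ b ⌋ ∧ ⌊ y ≟ a ⌋) ∨ (⌊ x ≟ a ⌋ ∧ ⌊ y ≟ b ⌋)
      ≡⟨ cong₂ _∨_ (∧-comm ⌊ x ≟ b ⌋ _) (∧-comm ⌊ x ≟ a ⌋ _) ⟩
    (⌊ y ≟ a ⌋ ∧ ⌊ x ≟ b ⌋) ∨ (⌊ y ≟ b ⌋ ∧ ⌊ x ≟ a ⌋) ∎

_⊆ᴳ_ : Graph n → Graph n → Set
G ⊆ᴳ H = ∀ {x y} → adj G x y ≡ true → adj H x y ≡ true

deleteGraphEdge-⊆ : deleteGraphEdge G a b ⊆ᴳ G
deleteGraphEdge-⊆ {G = G} = deleteEdge-⊆ (adj G)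

KeepsEdgesAvoiding : Fin n → Graph n → Graph n → Set
KeepsEdgesAvoiding w G H =
  ∀ {x y} → x ≢ w → y ≢ w → adj G x y ≡ true → adj H x y ≡ true

deleteGraphEdge-keepsEdgesAvoiding : KeepsEdgesAvoiding a G (deleteGraphEdge G a b)
deleteGraphEdge-keepsEdgesAvoiding {G = G} x≢a y≢a e =
  trans (deleteEdge-other (adj G) (inj₁ x≢a) (inj₂ y≢a)) e

mutual
  WStage-mono : G ⊆ᴳ H → ∀ k → WStage G X k v → WStage H X k v
  WStage-mono G⊆H zero v∈X = v∈X
  WStage-mono G⊆H (suc k) (u₁ , u₂ , u₁≢u₂ , e₁ , e₂ , w₁ , w₂) =
    u₁ , u₂ , u₁≢u₂ , G⊆H e₁ , G⊆H e₂ , WBelow-mono G⊆H (suc k) w₁ , WBelow-mono G⊆H (suc k) w₂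

  WBelow-mono : G ⊆ᴳ H → ∀ k → WBelow G X k v → WBelow H X k v
  WBelow-mono G⊆H (suc k) (inj₁ p) = inj₁ (WBelow-mono G⊆H k p)
  WBelow-mono G⊆H (suc k) (inj₂ p) = inj₂ (WStage-mono G⊆H k p)

InW-mono : G ⊆ᴳ H → InW G X v → InW H X v
InW-mono G⊆H (k , p) = k , WStage-mono G⊆H k p

WStage⇒WBelow : ∀ {k m} → suc k ≤′ m → WStage G X k v → WBelow G X m v
WStage⇒WBelow ≤′-refl      p = inj₂ p
WStage⇒WBelow (≤′-step k<m) p = inj₁ (WStage⇒WBelow k<m p)

InW-twoNeighbours : ∀ {u₁ u₂} → u₁ ≢ u₂ → adj G v u₁ ≡ true → adj G v u₂ ≡ true →
                    InW G X u₁ → InW G X u₂ → InW G X v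
InW-twoNeighbours u₁≢u₂ e₁ e₂ (k₁ , p₁) (k₂ , p₂) =
  suc (k₁ ⊔ k₂) , _ , _ , u₁≢u₂ , e₁ , e₂ ,
  WStage⇒WBelow (≤⇒≤′ (s≤s (m≤m⊔n k₁ k₂))) p₁ ,
  WStage⇒WBelow (≤⇒≤′ (s≤s (m≤n⊔m k₁ k₂))) p₂

mutual
  trapperWins⇒adjacent-InW : TrapperWins X (adj G) v → ∃ λ u → adj G v u ≡ true × InW G X u
  trapperWins⇒adjacent-InW (reachExit u e u∈X) = u , e , zero , u∈X
  trapperWins⇒adjacent-InW {G = G} (move u e storm)
    with afterDeletion⇒other-neighbour-InW {G = G} (storm _ (trans (sym G u _) e))
  ... | z₁ , _ , e₁ , w₁
    with afterDeletion⇒other-neighbour-InW {G = G} (storm z₁ e₁)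
  ... | z₂ , z₂≢z₁ , e₂ , w₂ =
    u , e , InW-twoNeighbours (≢-sym z₂≢z₁) e₁ e₂ w₁ w₂

  afterDeletion⇒other-neighbour-InW : ∀ {z} → TrapperWins X (deleteEdge (adj G) u z) u →
                                       ∃ λ z′ → z′ ≢ z × adj G u z′ ≡ true × InW G X z′
  afterDeletion⇒other-neighbour-InW {G = G} {u = u} {z = z} wins
    with trapperWins⇒adjacent-InW {G = deleteGraphEdge G u z} wins
  ... | z′ , e′ , w′ =
    z′ , deleteEdge-remaining≢ (adj G) e′ , deleteEdge-⊆ (adj G) e′ ,
    InW-mono (deleteGraphEdge-⊆ {G = G}) w′

-- H is quantified inside so that one case split serves every deletion the Storm can make.
SurvivesDeletionsAt : Fin n → Graph n → (Graph n → Fin n → Set) → Fin n → Set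
SurvivesDeletionsAt w G P u = u ≢ w × ∀ H → KeepsEdgesAvoiding w G H → P H u

mutual
  WStage-survives : ∀ k → WStage G X k u →
                    WBelow G X (suc k) w ⊎ SurvivesDeletionsAt w G (λ H → WStage H X k) u
  WStage-survives {u = u} {w = w} zero u∈X with u ≟ w
  ... | yes refl = inj₁ (inj₂ u∈X)
  ... | no u≢w   = inj₂ (u≢w , λ _ _ → u∈X)
  WStage-survives {u = u} {w = w} (suc k) p@(u₁ , u₂ , u₁≢u₂ , e₁ , e₂ , w₁ , w₂)
    with u ≟ w | WBelow-survives (suc k) w₁ | WBelow-survives (suc k) w₂
  ... | yes refl | _ | _ = inj₁ (inj₂ p)
  ... | no _ | inj₁ q | _ = inj₁ (inj₁ q)
  ... | no _ | inj₂ _ | inj₁ q = inj₁ (inj₁ q)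
  ... | no u≢w | inj₂ (u₁≢w , h₁) | inj₂ (u₂≢w , h₂) =
    inj₂ (u≢w , λ H keeps → u₁ , u₂ , u₁≢u₂ , keeps u≢w u₁≢w e₁ , keeps u≢w u₂≢w e₂ ,
                            h₁ H keeps , h₂ H keeps)

  WBelow-survives : ∀ k → WBelow G X k u →
                    WBelow G X k w ⊎ SurvivesDeletionsAt w G (λ H → WBelow H X k) u
  WBelow-survives (suc k) (inj₁ p) =
    ⊎-map inj₁ (map₂ (λ h H keeps → inj₁ (h H keeps))) (WBelow-survives k p)
  WBelow-survives (suc k) (inj₂ p) =
    ⊎-map id (map₂ (λ h H keeps → inj₂ (h H keeps))) (WStage-survives k p)

AdjacentWins : Subset n → ℕ → Set
AdjacentWins {n} X k =
  ∀ (G : Graph n) {v w} → WBelow G X k w → adj G v w ≡ true → TrapperWins X (adj G) v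

neighbourPair⇒trapperWins :
  ∀ {u₁ u₂} → AdjacentWins X k → u₁ ≢ u₂ → adj G w u₁ ≡ true → adj G w u₂ ≡ true →
  WBelow G X k w ⊎ SurvivesDeletionsAt w G (λ H → WBelow H X k) u₁ →
  WBelow G X k w ⊎ SurvivesDeletionsAt w G (λ H → WBelow H X k) u₂ →
  adj G v w ≡ true → TrapperWins X (adj G) v
neighbourPair⇒trapperWins {G = G} wins _ _ _ (inj₁ q) _        e = wins G q e
neighbourPair⇒trapperWins {G = G} wins _ _ _ (inj₂ _) (inj₁ q) e = wins G q e
neighbourPair⇒trapperWins {X = X} {k = k} {G = G} {w = w} {u₁ = u₁}
  wins u₁≢u₂ e₁ e₂ (inj₂ (u₁≢w , h₁)) (inj₂ (u₂≢w , h₂)) e = move w e storm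
  where
  continueVia : ∀ {x u} → u ≢ x → u ≢ w → adj G w u ≡ true →
                (∀ H → KeepsEdgesAvoiding w G H → WBelow H X k u) →
                TrapperWins X (deleteEdge (adj G) w x) w
  continueVia {x = x} u≢x u≢w e′ h =
    wins (deleteGraphEdge G w x) (h _ (deleteGraphEdge-keepsEdgesAvoiding {G = G}))
      (trans (deleteEdge-other (adj G) (inj₂ u≢x) (inj₂ u≢w)) e′)

  storm : ∀ x → adj G w x ≡ true → TrapperWins X (deleteEdge (adj G) w x) w
  storm x _ with u₁ ≟ x
  ... | yes refl = continueVia (≢-sym u₁≢u₂) u₂≢w e₂ h₂
  ... | no u₁≢x  = continueVia u₁≢x u₁≢w e₁ h₁

adjacent-WBelow⇒trapperWins : ∀ k → AdjacentWins X k
adjacent-WBelow⇒trapperWins (suc k) G (inj₁ p) e = adjacent-WBelow⇒trapperWins k G p e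
adjacent-WBelow⇒trapperWins (suc zero) G (inj₂ w∈X) e = reachExit _ e w∈X
adjacent-WBelow⇒trapperWins (suc (suc k)) G (inj₂ (_ , _ , u₁≢u₂ , e₁ , e₂ , w₁ , w₂)) e =
  neighbourPair⇒trapperWins (adjacent-WBelow⇒trapperWins (suc k)) u₁≢u₂ e₁ e₂
    (WBelow-survives (suc k) w₁) (WBelow-survives (suc k) w₂) e

theorem13 : ∀ (n : ℕ) (G : Graph n) (X : Subset n) (s : Fin n) →
    TrapperWins X (adj G) s ⇔ (∃ λ w → adj G s w ≡ true × InW G X w)
theorem13 n G X s = mk⇔ trapperWins⇒adjacent-InW
  (λ { (w , e , k , p) → adjacent-WBelow⇒trapperWins (suc k) G (inj₂ p) e })
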